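{- For every integer $n\ge 1$, the operator of multiplication by $q_n$ on $\mathbb C[p_1,p_3,p_5,\ldots]$ maps $\Delta$ into $2^{ -\frac{n+\varepsilon(n)-4}{2}}\Delta$.
   Context: Let $R=\mathbb C[p_1,p_3,p_5,\ldots]$ be the polynomial ring in variables $p_k$ indexed by odd positive integers $k$. For a partition $\mu=(\mu_1,\dots,\mu_\ell)$ all of whose parts are odd, set $p_\mu=p_{\mu_1}\cdots p_{\mu_\ell}$, $\ell(\mu)=\ell$, $|\mu|=\sum\mu_i$, and $z_\mu=\prod_{k \text{ odd}} k^{m_k}m_k!$ where $m_k$ is the multiplicity of $k$ as a part of $\mu$. For $n\ge 0$ define $$q_n=\sum_{\mu\vdash n,\ \text{all parts odd}} \frac{2^{\ell(\mu)}}{z_\mu}p_\mu .$$ Let $\mathbb Z_{(2)}=\{a/b: a,b\in\mathbb Z,\ b \text{ odd}\}$ and $\Delta=\mathbb Z_{(2)}[p_1,2p_3,4p_5,\ldots]=\mathbb Z_{(2)}[2^kp_{2k+1}:k\ge 0]\subset R$; as a $\mathbb Z_{(2)}$-module it has basis $2^{(|\mu|-\ell(\mu))/2}p_\mu$, $\mu$ ranging over partitions with odd parts. Let $\varepsilon(n)=0$ if $n$ is even and $\varepsilon(n)=1$ if $n$ is odd. For $c\in\mathbb Q$, $c\Delta=\{cx:x\in\Delta\}$. -}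

module Defs where

open import Data.Nat as ℕ using (ℕ; zero; suc; NonZero; _!)
open import Data.Nat.Properties as ℕP using (m*n≢0; m^n≢0; _!≢0)
open import Data.Nat.Divisibility using (_∣_)
open import Data.Integer using (+_)
open import Data.Rational as ℚ using (ℚ; 0ℚ; _+_; _*_; _/_; ↧ₙ_)
open import Data.List using (List; []; _∷_; map; concatMap; filter; foldr; upTo)
open import Data.List.Properties using (≡-dec)
open import Data.Product using (_×_; _,_; Σ; ∃)
open import Relation.Nullary using (¬_; yes; no)
open import Relation.Binary.PropositionalEquality using (_≡_)

-- Monomials in p₁, p₃, p₅, … are exponent vectors:
-- the entry at index k is the exponent of p_{2k+1}.  A monomial is thus
-- the same thing as a partition μ with odd parts (m_{2k+1} = entry k).
-- Vectors differing only by trailing zeros denote the same monomial.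

Mono : Set
Mono = List ℕ

strip : Mono → Mono
strip [] = []
strip (e ∷ m) with strip m
... | [] with e
...   | zero  = []
...   | suc e' = suc e' ∷ []
strip (e ∷ m) | (x ∷ xs) = e ∷ x ∷ xs

mmul : Mono → Mono → Mono
mmul [] m' = m'
mmul (e ∷ m) [] = e ∷ m
mmul (e ∷ m) (e' ∷ m') = (e ℕ.+ e') ∷ mmul m m'

-- Polynomials with rational coefficients: finite formal sums of terms.
-- (All elements relevant to the statement have rational coefficients.)

Poly : Set
Poly = List (ℚ × Mono)

sumℚ : List ℚ → ℚ
sumℚ = foldr _+_ 0ℚ

coeff : Poly → Mono → ℚ
coeff [] m = 0ℚ
coeff ((a , m') ∷ P) m with ≡-dec ℕ._≟_ (strip m') (strip m)
... | yes _ = a + coeff P m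
... | no  _ = coeff P m

_≈P_ : Poly → Poly → Set
P ≈P Q = ∀ m → coeff P m ≡ coeff Q m

_*P_ : Poly → Poly → Poly
P *P Q = concatMap (λ { (a , m) → map (λ { (b , m') → (a * b , mmul m m') }) Q }) P

_·P_ : ℚ → Poly → Poly
c ·P P = map (λ { (a , m) → (c * a , m) }) P

-- Statistics of the odd partition μ encoded by an exponent vector
-- (the argument k is the index offset: entry i stands for part 2(k+i)+1).

sizeFrom : ℕ → Mono → ℕ
sizeFrom k [] = 0
sizeFrom k (e ∷ m) = (suc (2 ℕ.* k)) ℕ.* e ℕ.+ sizeFrom (suc k) m

size : Mono → ℕ
size = sizeFrom 0

len : Mono → ℕ
len [] = 0
len (e ∷ m) = e ℕ.+ len m

weightFrom : ℕ → Mono → ℕ          -- (|μ| - ℓ(μ)) / 2 = Σ_k k·m_{2k+1}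
weightFrom k [] = 0
weightFrom k (e ∷ m) = k ℕ.* e ℕ.+ weightFrom (suc k) m

weight : Mono → ℕ
weight = weightFrom 0

zFrom : ℕ → Mono → ℕ
zFrom k [] = 1
zFrom k (e ∷ m) = ((suc (2 ℕ.* k)) ℕ.^ e ℕ.* e !) ℕ.* zFrom (suc k) m

zFrom≢0 : ∀ k m → NonZero (zFrom k m)
zFrom≢0 k [] = _
zFrom≢0 k (e ∷ m) =
  m*n≢0 _ _ {{m*n≢0 _ _ {{m^n≢0 (suc (2 ℕ.* k)) e}} {{e !≢0}}}}
            {{zFrom≢0 (suc k) m}}

z : Mono → ℕ
z = zFrom 0

-- Odd partitions of n are enumerated as the exponent vectors of length n
-- (parts 1,3,…,2n-1) with entries in {0,…,n} and size n; each odd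
-- partition of n occurs exactly once in this list.

vecs : ℕ → ℕ → List Mono
vecs zero b = [] ∷ []
vecs (suc L) b = concatMap (λ e → map (e ∷_) (vecs L b)) (upTo (suc b))

oddPartitions : ℕ → List Mono
oddPartitions n = filter (λ m → size m ℕ.≟ n) (vecs n n)

qCoeff : Mono → ℚ
qCoeff m = (+ (2 ℕ.^ len m)) / z m
  where instance _ = zFrom≢0 0 m

q : ℕ → Poly
q n = map (λ m → (qCoeff m , m)) (oddPartitions n)

-- ℤ₍₂₎ = { a/b : b odd }: a rational lies in ℤ₍₂₎ iff its reduced
-- denominator is odd.

Inℤ₍₂₎ : ℚ → Set
Inℤ₍₂₎ r = ¬ (2 ∣ ↧ₙ r)

inv2^ : ℕ → ℚ
inv2^ w = (+ 1) / (2 ℕ.^ w)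
  where instance _ = m^n≢0 2 w

-- Δ = ℤ₍₂₎[p₁, 2p₃, 4p₅, …], described through its ℤ₍₂₎-basis
-- 2^{(|μ|-ℓ(μ))/2} p_μ : P ∈ Δ iff the coefficient of each p_μ,
-- divided by 2^{(|μ|-ℓ(μ))/2}, lies in ℤ₍₂₎.
InΔ : Poly → Set
InΔ P = ∀ m → Inℤ₍₂₎ (coeff P m * inv2^ (weight m))

InScaledΔ : ℚ → Poly → Set
InScaledΔ c x = Σ Poly (λ y → InΔ y × (x ≈P (c ·P y)))

ε : ℕ → ℕ
ε n = n ℕ.% 2

-- 2^{-(n+ε(n)-4)/2} = 4 / 2^{(n+ε(n))/2}   (n + ε(n) is even)
scale : ℕ → ℚ
scale n = (+ 4) / (2 ℕ.^ ((n ℕ.+ ε n) ℕ./ 2))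
  where instance _ = m^n≢0 2 ((n ℕ.+ ε n) ℕ./ 2)

-- The coefficient of p_μ in q_n · x is Σ_ν c_ν x_{μ/ν}, summed over the odd partitions ν ⊢ n
-- dividing μ, where c_ν = 2^ℓ(ν) / z_ν.  Since the weight w(μ) = (|μ| - ℓ(μ)) / 2 is additive,
-- it suffices that every 2^(⌈n/2⌉ - 2) · c_ν · 2^(-w(ν)) lies in ℤ₍₂₎.  By Legendre's formula
-- v₂(e!) ≤ e - 1, so v₂(z_ν) ≤ ℓ(ν) - 1; and n = ℓ(ν) + 2 w(ν) with ℓ(ν) ≥ 1 forces w(ν) < ⌈n/2⌉.
-- Together the exponent of 2 is at least ⌈n/2⌉ - 2 + ℓ(ν) - (ℓ(ν) - 1) - w(ν) ≥ 0.

module Submission where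

open import Defs
open import Data.Nat using (ℕ; _≤_)

module Monomials where

  open import Data.Nat using (ℕ; zero; suc; _+_; _*_; _∸_; _≟_)
  open import Data.Nat.Properties
    using (+-identityʳ; *-zeroʳ; 0∸n≡0; m+n∸m≡n; *-distribˡ-+; m+n≡0⇒m≡0; m+n≡0⇒n≡0)
  open import Data.Nat.Solver using (module +-*-Solver)
  open import Data.List using ([]; _∷_)
  open import Data.List.Properties using (≡-dec)
  open import Relation.Binary.PropositionalEquality
  open import Relation.Nullary using (Dec)
  open +-*-Solver

  exponent : Mono → ℕ → ℕ
  exponent []      i       = 0
  exponent (e ∷ m) zero    = e
  exponent (e ∷ m) (suc i) = exponent m i

  _≋_ : Mono → Mono → Set
  a ≋ b = ∀ i → exponent a i ≡ exponent b i

  consStripped : ℕ → Mono → Mono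
  consStripped e       (x ∷ xs) = e ∷ x ∷ xs
  consStripped zero    []       = []
  consStripped (suc e) []       = suc e ∷ []

  strip-∷ : ∀ e m → strip (e ∷ m) ≡ consStripped e (strip m)
  strip-∷ e m with strip m
  ... | [] with e
  ...   | zero  = refl
  ...   | suc _ = refl
  strip-∷ e m | _ ∷ _ = refl

  consStripped-≋ : ∀ e s → consStripped e s ≋ (e ∷ s)
  consStripped-≋ e       (x ∷ xs) i       = refl
  consStripped-≋ zero    []       zero    = refl
  consStripped-≋ zero    []       (suc i) = refl
  consStripped-≋ (suc e) []       i       = refl

  strip-≋ : ∀ m → strip m ≋ m
  strip-≋ []      i = refl
  strip-≋ (e ∷ m) i rewrite strip-∷ e m =
    trans (consStripped-≋ e (strip m) i) (tail-≋ i)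
    where
    tail-≋ : (e ∷ strip m) ≋ (e ∷ m)
    tail-≋ zero    = refl
    tail-≋ (suc i) = strip-≋ m i

  ≋⇒strip≡ : ∀ a b → a ≋ b → strip a ≡ strip b
  ≋⇒strip≡ []      []       a≋b = refl
  ≋⇒strip≡ []      (e′ ∷ b) a≋b rewrite strip-∷ e′ b | sym (a≋b 0)
    | sym (≋⇒strip≡ [] b (λ i → a≋b (suc i))) = refl
  ≋⇒strip≡ (e ∷ a) []       a≋b rewrite strip-∷ e a | a≋b 0
    | ≋⇒strip≡ a [] (λ i → a≋b (suc i)) = refl
  ≋⇒strip≡ (e ∷ a) (e′ ∷ b) a≋b rewrite strip-∷ e a | strip-∷ e′ b | a≋b 0
    | ≋⇒strip≡ a b (λ i → a≋b (suc i)) = refl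

  strip≡⇒≋ : ∀ a b → strip a ≡ strip b → a ≋ b
  strip≡⇒≋ a b eq i =
    trans (sym (strip-≋ a i)) (trans (cong (λ s → exponent s i) eq) (strip-≋ b i))

  weightFrom-consStripped : ∀ k e s →
    weightFrom k (consStripped e s) ≡ k * e + weightFrom (suc k) s
  weightFrom-consStripped k e       (x ∷ s) = refl
  weightFrom-consStripped k zero    []      = sym (cong (_+ 0) (*-zeroʳ k))
  weightFrom-consStripped k (suc e) []      = refl

  weightFrom-strip : ∀ k m → weightFrom k (strip m) ≡ weightFrom k m
  weightFrom-strip k []      = refl
  weightFrom-strip k (e ∷ m) rewrite strip-∷ e m =
    trans (weightFrom-consStripped k e (strip m)) (cong (k * e +_) (weightFrom-strip (suc k) m))

  strip≡⇒weight≡ : ∀ a b → strip a ≡ strip b → weight a ≡ weight b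
  strip≡⇒weight≡ a b eq =
    trans (sym (weightFrom-strip 0 a)) (trans (cong weight eq) (weightFrom-strip 0 b))

  -- exponentwise truncated difference: the quotient m / m₁ whenever m₁ divides m
  mdiv : Mono → Mono → Mono
  mdiv []      b        = []
  mdiv (e ∷ a) []       = e ∷ a
  mdiv (e ∷ a) (e′ ∷ b) = (e ∸ e′) ∷ mdiv a b

  exponent-mmul : ∀ a b i → exponent (mmul a b) i ≡ exponent a i + exponent b i
  exponent-mmul []      b        i       = refl
  exponent-mmul (e ∷ a) []       zero    = sym (+-identityʳ e)
  exponent-mmul (e ∷ a) []       (suc i) = sym (+-identityʳ _)
  exponent-mmul (e ∷ a) (e′ ∷ b) zero    = refl
  exponent-mmul (e ∷ a) (e′ ∷ b) (suc i) = exponent-mmul a b i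

  exponent-mdiv : ∀ a b i → exponent (mdiv a b) i ≡ exponent a i ∸ exponent b i
  exponent-mdiv []      []       i       = refl
  exponent-mdiv []      (x ∷ b)  zero    = sym (0∸n≡0 x)
  exponent-mdiv []      (x ∷ b)  (suc i) = sym (0∸n≡0 (exponent b i))
  exponent-mdiv (e ∷ a) []       zero    = refl
  exponent-mdiv (e ∷ a) []       (suc i) = refl
  exponent-mdiv (e ∷ a) (e′ ∷ b) zero    = refl
  exponent-mdiv (e ∷ a) (e′ ∷ b) (suc i) = exponent-mdiv a b i

  weightFrom-mmul : ∀ k a b → weightFrom k (mmul a b) ≡ weightFrom k a + weightFrom k b
  weightFrom-mmul k []      b        = refl
  weightFrom-mmul k (e ∷ a) []       = sym (+-identityʳ _)
  weightFrom-mmul k (e ∷ a) (e′ ∷ b)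
    rewrite weightFrom-mmul (suc k) a b | *-distribˡ-+ k e e′ =
    solve 4 (λ x y u v → x :+ y :+ (u :+ v) := x :+ u :+ (y :+ v)) refl
      (k * e) (k * e′) (weightFrom (suc k) a) (weightFrom (suc k) b)

  _∣ᴹ_ : Mono → Mono → Set
  m₁ ∣ᴹ m = strip (mmul m₁ (mdiv m m₁)) ≡ strip m

  _∣ᴹ?_ : ∀ m₁ m → Dec (m₁ ∣ᴹ m)
  m₁ ∣ᴹ? m = ≡-dec _≟_ (strip (mmul m₁ (mdiv m m₁))) (strip m)

  mmul≡⇒≡mdiv : ∀ m₁ m′ m → strip (mmul m₁ m′) ≡ strip m → strip m′ ≡ strip (mdiv m m₁)
  mmul≡⇒≡mdiv m₁ m′ m eq = ≋⇒strip≡ m′ (mdiv m m₁) λ i → begin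
    exponent m′ i
      ≡⟨ m+n∸m≡n (exponent m₁ i) (exponent m′ i) ⟨
    exponent m₁ i + exponent m′ i ∸ exponent m₁ i
      ≡⟨ cong (_∸ exponent m₁ i) (exponent-mmul m₁ m′ i) ⟨
    exponent (mmul m₁ m′) i ∸ exponent m₁ i
      ≡⟨ cong (_∸ exponent m₁ i) (strip≡⇒≋ (mmul m₁ m′) m eq i) ⟩
    exponent m i ∸ exponent m₁ i
      ≡⟨ exponent-mdiv m m₁ i ⟨
    exponent (mdiv m m₁) i ∎
    where open ≡-Reasoning

  ∣ᴹ-mmul : ∀ m₁ m′ m → m₁ ∣ᴹ m → strip m′ ≡ strip (mdiv m m₁) → strip (mmul m₁ m′) ≡ strip m
  ∣ᴹ-mmul m₁ m′ m m₁∣m eq = ≋⇒strip≡ (mmul m₁ m′) m λ i → begin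
    exponent (mmul m₁ m′) i
      ≡⟨ exponent-mmul m₁ m′ i ⟩
    exponent m₁ i + exponent m′ i
      ≡⟨ cong (exponent m₁ i +_) (strip≡⇒≋ m′ (mdiv m m₁) eq i) ⟩
    exponent m₁ i + exponent (mdiv m m₁) i
      ≡⟨ exponent-mmul m₁ (mdiv m m₁) i ⟨
    exponent (mmul m₁ (mdiv m m₁)) i
      ≡⟨ strip≡⇒≋ (mmul m₁ (mdiv m m₁)) m m₁∣m i ⟩
    exponent m i ∎
    where open ≡-Reasoning

  mmul≡⇒∣ᴹ : ∀ m₁ m′ m → strip (mmul m₁ m′) ≡ strip m → m₁ ∣ᴹ m
  mmul≡⇒∣ᴹ m₁ m′ m eq = ≋⇒strip≡ (mmul m₁ (mdiv m m₁)) m λ i → begin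
    exponent (mmul m₁ (mdiv m m₁)) i
      ≡⟨ exponent-mmul m₁ (mdiv m m₁) i ⟩
    exponent m₁ i + exponent (mdiv m m₁) i
      ≡⟨ cong (exponent m₁ i +_) (strip≡⇒≋ m′ (mdiv m m₁) (mmul≡⇒≡mdiv m₁ m′ m eq) i) ⟨
    exponent m₁ i + exponent m′ i
      ≡⟨ exponent-mmul m₁ m′ i ⟨
    exponent (mmul m₁ m′) i
      ≡⟨ strip≡⇒≋ (mmul m₁ m′) m eq i ⟩
    exponent m i ∎
    where open ≡-Reasoning

  sizeFrom≡len+2*weightFrom : ∀ k m → sizeFrom k m ≡ len m + 2 * weightFrom k m
  sizeFrom≡len+2*weightFrom k []      = refl
  sizeFrom≡len+2*weightFrom k (e ∷ m) rewrite sizeFrom≡len+2*weightFrom (suc k) m =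
    solve 4 (λ k e L W → (con 1 :+ con 2 :* k) :* e :+ (L :+ con 2 :* W)
                       := e :+ L :+ con 2 :* (k :* e :+ W))
      refl k e (len m) (weightFrom (suc k) m)

  len≡0⇒sizeFrom≡0 : ∀ k m → len m ≡ 0 → sizeFrom k m ≡ 0
  len≡0⇒sizeFrom≡0 k []      _   = refl
  len≡0⇒sizeFrom≡0 k (e ∷ m) eq
    rewrite m+n≡0⇒m≡0 e eq | len≡0⇒sizeFrom≡0 (suc k) m (m+n≡0⇒n≡0 e eq) =
    cong (_+ 0) (*-zeroʳ (suc (2 * k)))

module Coefficients where

  open Monomials
  open import Data.Nat using (_≟_)
  open import Data.Rational using (0ℚ; _+_; _*_)
  open import Data.Rational.Properties using (+-identityˡ; +-assoc; *-zeroʳ; *-distribˡ-+)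
  open import Data.List using ([]; _∷_; _++_)
  open import Data.List.Properties using (≡-dec; ++-assoc)
  open import Data.Product using (_,_)
  open import Relation.Binary.PropositionalEquality
  open import Relation.Nullary using (¬_; yes; no)
  open import Data.Empty using (⊥-elim)

  coeff-++ : ∀ P Q m → coeff (P ++ Q) m ≡ coeff P m + coeff Q m
  coeff-++ []              Q m = sym (+-identityˡ _)
  coeff-++ ((a , m′) ∷ P) Q m with ≡-dec _≟_ (strip m′) (strip m)
  ... | yes _ = trans (cong (a +_) (coeff-++ P Q m)) (sym (+-assoc a _ _))
  ... | no  _ = coeff-++ P Q m

  coeff-·P : ∀ c P m → coeff (c ·P P) m ≡ c * coeff P m
  coeff-·P c []              m = sym (*-zeroʳ c)
  coeff-·P c ((a , m′) ∷ P) m with ≡-dec _≟_ (strip m′) (strip m)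
  ... | yes _ = trans (cong (c * a +_) (coeff-·P c P m)) (sym (*-distribˡ-+ c a _))
  ... | no  _ = coeff-·P c P m

  *P-distribʳ-++ : ∀ P P′ Q → (P ++ P′) *P Q ≡ (P *P Q) ++ (P′ *P Q)
  *P-distribʳ-++ []       P′ Q = refl
  *P-distribʳ-++ (t ∷ P) P′ Q =
    trans (cong₂ _++_ refl (*P-distribʳ-++ P P′ Q)) (sym (++-assoc _ (P *P Q) (P′ *P Q)))

  coeff-∷-*P : ∀ t P Q m → coeff ((t ∷ P) *P Q) m ≡ coeff ((t ∷ []) *P Q) m + coeff (P *P Q) m
  coeff-∷-*P t P Q m =
    trans (cong (λ R → coeff R m) (*P-distribʳ-++ (t ∷ []) P Q)) (coeff-++ ((t ∷ []) *P Q) (P *P Q) m)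

  coeff-term-*P : ∀ a m₁ Q m → m₁ ∣ᴹ m →
    coeff (((a , m₁) ∷ []) *P Q) m ≡ a * coeff Q (mdiv m m₁)
  coeff-term-*P a m₁ []              m m₁∣m = sym (*-zeroʳ a)
  coeff-term-*P a m₁ ((b , m′) ∷ Q) m m₁∣m
    with ≡-dec _≟_ (strip (mmul m₁ m′)) (strip m) | ≡-dec _≟_ (strip m′) (strip (mdiv m m₁))
  ... | yes _  | yes _  = trans (cong (a * b +_) (coeff-term-*P a m₁ Q m m₁∣m)) (sym (*-distribˡ-+ a b _))
  ... | yes eq | no neq = ⊥-elim (neq (mmul≡⇒≡mdiv m₁ m′ m eq))
  ... | no neq | yes eq = ⊥-elim (neq (∣ᴹ-mmul m₁ m′ m m₁∣m eq))
  ... | no _   | no _   = coeff-term-*P a m₁ Q m m₁∣m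

  coeff-term-*P-∤ : ∀ a m₁ Q m → ¬ m₁ ∣ᴹ m → coeff (((a , m₁) ∷ []) *P Q) m ≡ 0ℚ
  coeff-term-*P-∤ a m₁ []              m m₁∤m = refl
  coeff-term-*P-∤ a m₁ ((b , m′) ∷ Q) m m₁∤m with ≡-dec _≟_ (strip (mmul m₁ m′)) (strip m)
  ... | yes eq = ⊥-elim (m₁∤m (mmul≡⇒∣ᴹ m₁ m′ m eq))
  ... | no _   = coeff-term-*P-∤ a m₁ Q m m₁∤m

module TwoAdicIntegers where

  open import Data.Nat as ℕ using (ℕ; zero; suc; s≤s)
  open import Data.Nat.Properties using (+-comm; *-comm)
  open import Data.Nat.Divisibility using (_∣_; divides; ∣-trans; ∣⇒≤; ∣m+n∣m⇒∣n)
  open import Data.Nat.Primality using (euclidsLemma; prime[2])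
  open import Data.Nat.Coprimality as Coprime using (coprime-divisor; coprime?)
  open import Data.Integer as ℤ using (ℤ; +_; +[1+_])
  open import Data.Integer.Properties using (pos-*; abs-*; *-cancelʳ-≡)
  open import Data.Integer.Solver using (module +-*-Solver)
  open import Data.Rational using (mkℚ; 0ℚ; _+_; _*_; toℚᵘ)
  open import Data.Rational.Properties using (toℚᵘ-homo-+; toℚᵘ-homo-*)
  open import Data.Rational.Unnormalised as ℚᵘ using (ℚᵘ; mkℚᵘ; _≃_; *≡*)
  import Data.Rational.Unnormalised.Properties as ℚᵘ
  open import Data.Product using (_×_; _,_; Σ)
  open import Data.Sum using (inj₁; inj₂)
  open import Relation.Binary.PropositionalEquality
  open import Relation.Nullary using (¬_)
  open import Relation.Nullary.Decidable using (recompute)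
  open +-*-Solver

  Odd : ℕ → Set
  Odd b = ¬ 2 ∣ b

  odd-1 : Odd 1
  odd-1 2∣1 with ∣⇒≤ 2∣1
  ... | s≤s ()

  odd-* : ∀ {b c} → Odd b → Odd c → Odd (b ℕ.* c)
  odd-* {b} {c} odd-b odd-c 2∣bc with euclidsLemma b c prime[2] 2∣bc
  ... | inj₁ 2∣b = odd-b 2∣b
  ... | inj₂ 2∣c = odd-c 2∣c

  odd-^ : ∀ {b} e → Odd b → Odd (b ℕ.^ e)
  odd-^ zero    odd-b = odd-1
  odd-^ (suc e) odd-b = odd-* odd-b (odd-^ e odd-b)

  odd-1+2* : ∀ k → Odd (suc (2 ℕ.* k))
  odd-1+2* k 2∣1+2k =
    odd-1 (∣m+n∣m⇒∣n (subst (2 ∣_) (+-comm 1 (2 ℕ.* k)) 2∣1+2k) (divides k (*-comm 2 k)))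

  -- u = a / b for some odd b; unlike Inℤ₍₂₎ this needs no reduced form
  Inℤ₍₂₎ᵘ : ℚᵘ → Set
  Inℤ₍₂₎ᵘ u = Σ ℤ λ a → Σ ℕ λ b → Odd b × (ℚᵘ.↥ u ℤ.* + b ≡ a ℤ.* ℚᵘ.↧ u)

  Inℤ₍₂₎ᵘ-resp-≃ : ∀ {u v} → u ≃ v → Inℤ₍₂₎ᵘ u → Inℤ₍₂₎ᵘ v
  Inℤ₍₂₎ᵘ-resp-≃ {mkℚᵘ n₁ d₁} {mkℚᵘ n₂ d₂} (*≡* eq) (a , b , odd-b , h) =
    a , b , odd-b , *-cancelʳ-≡ _ _ +[1+ d₁ ] (begin
      n₂ ℤ.* + b ℤ.* +[1+ d₁ ]
        ≡⟨ solve 3 (λ n b d → n :* b :* d := n :* d :* b) refl n₂ (+ b) +[1+ d₁ ] ⟩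
      n₂ ℤ.* +[1+ d₁ ] ℤ.* + b
        ≡⟨ cong (ℤ._* + b) eq ⟨
      n₁ ℤ.* +[1+ d₂ ] ℤ.* + b
        ≡⟨ solve 3 (λ n b d → n :* d :* b := n :* b :* d) refl n₁ (+ b) +[1+ d₂ ] ⟩
      n₁ ℤ.* + b ℤ.* +[1+ d₂ ]
        ≡⟨ cong (ℤ._* +[1+ d₂ ]) h ⟩
      a ℤ.* +[1+ d₁ ] ℤ.* +[1+ d₂ ]
        ≡⟨ solve 3 (λ a x y → a :* x :* y := a :* y :* x) refl a +[1+ d₁ ] +[1+ d₂ ] ⟩
      a ℤ.* +[1+ d₂ ] ℤ.* +[1+ d₁ ] ∎)
    where open ≡-Reasoning

  Inℤ₍₂₎ᵘ-+ : ∀ {u v} → Inℤ₍₂₎ᵘ u → Inℤ₍₂₎ᵘ v → Inℤ₍₂₎ᵘ (u ℚᵘ.+ v)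
  Inℤ₍₂₎ᵘ-+ {mkℚᵘ n₁ d₁} {mkℚᵘ n₂ d₂} (a₁ , b₁ , odd-b₁ , h₁) (a₂ , b₂ , odd-b₂ , h₂) =
    a₁ ℤ.* + b₂ ℤ.+ a₂ ℤ.* + b₁ , b₁ ℕ.* b₂ , odd-* odd-b₁ odd-b₂ , (begin
      (n₁ ℤ.* D₂ ℤ.+ n₂ ℤ.* D₁) ℤ.* + (b₁ ℕ.* b₂)
        ≡⟨ cong ((n₁ ℤ.* D₂ ℤ.+ n₂ ℤ.* D₁) ℤ.*_) (pos-* b₁ b₂) ⟩
      (n₁ ℤ.* D₂ ℤ.+ n₂ ℤ.* D₁) ℤ.* (+ b₁ ℤ.* + b₂)
        ≡⟨ solve 6 (λ n₁ n₂ D₁ D₂ B₁ B₂ → (n₁ :* D₂ :+ n₂ :* D₁) :* (B₁ :* B₂)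
                    := (n₁ :* B₁) :* (D₂ :* B₂) :+ (n₂ :* B₂) :* (D₁ :* B₁))
             refl n₁ n₂ D₁ D₂ (+ b₁) (+ b₂) ⟩
      (n₁ ℤ.* + b₁) ℤ.* (D₂ ℤ.* + b₂) ℤ.+ (n₂ ℤ.* + b₂) ℤ.* (D₁ ℤ.* + b₁)
        ≡⟨ cong₂ (λ x y → x ℤ.* (D₂ ℤ.* + b₂) ℤ.+ y ℤ.* (D₁ ℤ.* + b₁)) h₁ h₂ ⟩
      (a₁ ℤ.* D₁) ℤ.* (D₂ ℤ.* + b₂) ℤ.+ (a₂ ℤ.* D₂) ℤ.* (D₁ ℤ.* + b₁)
        ≡⟨ solve 6 (λ a₁ a₂ D₁ D₂ B₁ B₂ → (a₁ :* D₁) :* (D₂ :* B₂) :+ (a₂ :* D₂) :* (D₁ :* B₁)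
                    := (a₁ :* B₂ :+ a₂ :* B₁) :* (D₁ :* D₂)) refl a₁ a₂ D₁ D₂ (+ b₁) (+ b₂) ⟩
      (a₁ ℤ.* + b₂ ℤ.+ a₂ ℤ.* + b₁) ℤ.* (D₁ ℤ.* D₂)
        ≡⟨ cong ((a₁ ℤ.* + b₂ ℤ.+ a₂ ℤ.* + b₁) ℤ.*_) (pos-* (suc d₁) (suc d₂)) ⟨
      (a₁ ℤ.* + b₂ ℤ.+ a₂ ℤ.* + b₁) ℤ.* + (suc d₁ ℕ.* suc d₂) ∎)
    where
    open ≡-Reasoning
    D₁ = +[1+ d₁ ]
    D₂ = +[1+ d₂ ]

  Inℤ₍₂₎ᵘ-* : ∀ {u v} → Inℤ₍₂₎ᵘ u → Inℤ₍₂₎ᵘ v → Inℤ₍₂₎ᵘ (u ℚᵘ.* v)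
  Inℤ₍₂₎ᵘ-* {mkℚᵘ n₁ d₁} {mkℚᵘ n₂ d₂} (a₁ , b₁ , odd-b₁ , h₁) (a₂ , b₂ , odd-b₂ , h₂) =
    a₁ ℤ.* a₂ , b₁ ℕ.* b₂ , odd-* odd-b₁ odd-b₂ , (begin
      (n₁ ℤ.* n₂) ℤ.* + (b₁ ℕ.* b₂)       ≡⟨ cong ((n₁ ℤ.* n₂) ℤ.*_) (pos-* b₁ b₂) ⟩
      (n₁ ℤ.* n₂) ℤ.* (+ b₁ ℤ.* + b₂)     ≡⟨ solve 4 (λ n₁ n₂ B₁ B₂ → (n₁ :* n₂) :* (B₁ :* B₂)
                                                     := (n₁ :* B₁) :* (n₂ :* B₂)) refl n₁ n₂ (+ b₁) (+ b₂) ⟩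
      (n₁ ℤ.* + b₁) ℤ.* (n₂ ℤ.* + b₂)     ≡⟨ cong₂ ℤ._*_ h₁ h₂ ⟩
      (a₁ ℤ.* D₁) ℤ.* (a₂ ℤ.* D₂)         ≡⟨ solve 4 (λ a₁ a₂ D₁ D₂ → (a₁ :* D₁) :* (a₂ :* D₂)
                                                     := (a₁ :* a₂) :* (D₁ :* D₂)) refl a₁ a₂ D₁ D₂ ⟩
      (a₁ ℤ.* a₂) ℤ.* (D₁ ℤ.* D₂)         ≡⟨ cong ((a₁ ℤ.* a₂) ℤ.*_) (pos-* (suc d₁) (suc d₂)) ⟨
      (a₁ ℤ.* a₂) ℤ.* + (suc d₁ ℕ.* suc d₂) ∎)
    where
    open ≡-Reasoning
    D₁ = +[1+ d₁ ]
    D₂ = +[1+ d₂ ]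

  Inℤ₍₂₎⇒Inℤ₍₂₎ᵘ : ∀ r → Inℤ₍₂₎ r → Inℤ₍₂₎ᵘ (toℚᵘ r)
  Inℤ₍₂₎⇒Inℤ₍₂₎ᵘ (mkℚ n d _) odd-d = n , suc d , odd-d , refl

  -- the reduced denominator divides every odd b with r = a / b
  Inℤ₍₂₎ᵘ⇒Inℤ₍₂₎ : ∀ r → Inℤ₍₂₎ᵘ (toℚᵘ r) → Inℤ₍₂₎ r
  Inℤ₍₂₎ᵘ⇒Inℤ₍₂₎ (mkℚ n d coprime) (a , b , odd-b , h) 2∣d = odd-b (∣-trans 2∣d d∣b)
    where
    d⊥n : Coprime.Coprime (suc d) ℤ.∣ n ∣
    d⊥n = Coprime.sym (recompute (coprime? ℤ.∣ n ∣ (suc d)) coprime)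
    d∣b : suc d ∣ b
    d∣b = coprime-divisor d⊥n
      (divides ℤ.∣ a ∣ (trans (sym (abs-* n (+ b))) (trans (cong ℤ.∣_∣ h) (abs-* a +[1+ d ]))))

  Inℤ₍₂₎-0 : Inℤ₍₂₎ 0ℚ
  Inℤ₍₂₎-0 = odd-1

  Inℤ₍₂₎-+ : ∀ {p q} → Inℤ₍₂₎ p → Inℤ₍₂₎ q → Inℤ₍₂₎ (p + q)
  Inℤ₍₂₎-+ {p} {q} p∈ q∈ = Inℤ₍₂₎ᵘ⇒Inℤ₍₂₎ (p + q)
    (Inℤ₍₂₎ᵘ-resp-≃ {toℚᵘ p ℚᵘ.+ toℚᵘ q} (ℚᵘ.≃-sym (toℚᵘ-homo-+ p q))
      (Inℤ₍₂₎ᵘ-+ {toℚᵘ p} {toℚᵘ q} (Inℤ₍₂₎⇒Inℤ₍₂₎ᵘ p p∈) (Inℤ₍₂₎⇒Inℤ₍₂₎ᵘ q q∈)))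

  Inℤ₍₂₎-* : ∀ {p q} → Inℤ₍₂₎ p → Inℤ₍₂₎ q → Inℤ₍₂₎ (p * q)
  Inℤ₍₂₎-* {p} {q} p∈ q∈ = Inℤ₍₂₎ᵘ⇒Inℤ₍₂₎ (p * q)
    (Inℤ₍₂₎ᵘ-resp-≃ {toℚᵘ p ℚᵘ.* toℚᵘ q} (ℚᵘ.≃-sym (toℚᵘ-homo-* p q))
      (Inℤ₍₂₎ᵘ-* {toℚᵘ p} {toℚᵘ q} (Inℤ₍₂₎⇒Inℤ₍₂₎ᵘ p p∈) (Inℤ₍₂₎⇒Inℤ₍₂₎ᵘ q q∈)))

  Inℤ₍₂₎-2^e/odd : ∀ r x y .{{_ : ℕ.NonZero y}} e o → toℚᵘ r ≃ (+ x) ℚᵘ./ y →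
                   Odd o → x ℕ.* o ≡ 2 ℕ.^ e ℕ.* y → Inℤ₍₂₎ r
  Inℤ₍₂₎-2^e/odd r x (suc y) e o r≃x/y odd-o eq = Inℤ₍₂₎ᵘ⇒Inℤ₍₂₎ r
    (Inℤ₍₂₎ᵘ-resp-≃ (ℚᵘ.≃-sym r≃x/y)
      (+ (2 ℕ.^ e) , o , odd-o , trans (sym (pos-* x o)) (trans (cong +_ eq) (pos-* (2 ℕ.^ e) (suc y)))))

module Fractions where

  open import Data.Nat as ℕ using (ℕ; zero; suc; NonZero; _+_; _*_; _^_; _≤_; s≤s; z≤n)
  open import Data.Nat.Properties using (m*n≢0; m^n≢0; ^-distribˡ-+-*; *-comm; *-suc)
  open import Data.Nat.DivMod using (+-distrib-/-∣ˡ)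
  open import Data.Nat.Divisibility using (∣-refl)
  open import Data.Integer as ℤ using (+_; +[1+_])
  open import Data.Integer.Properties using (pos-*; *-identityʳ; *-identityˡ)
  open import Data.Rational as ℚ using (ℚ; 1ℚ; toℚᵘ)
  open import Data.Rational.Properties using (toℚᵘ-homo-*; toℚᵘ-fromℚᵘ; toℚᵘ-injective)
  open import Data.Rational.Unnormalised as ℚᵘ using (mkℚᵘ; _≃_; *≡*)
  import Data.Rational.Unnormalised.Properties as ℚᵘ
  open import Relation.Binary.PropositionalEquality

  toℚᵘ-/ : ∀ i d .{{_ : NonZero d}} → toℚᵘ (i ℚ./ d) ≃ i ℚᵘ./ d
  toℚᵘ-/ i (suc d) = toℚᵘ-fromℚᵘ (mkℚᵘ i d)

  /-*-/ : ∀ x y x′ y′ .{{_ : NonZero y}} .{{_ : NonZero y′}} .{{_ : NonZero (y * y′)}} →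
          (+ x ℚᵘ./ y) ℚᵘ.* (+ x′ ℚᵘ./ y′) ≃ + (x * x′) ℚᵘ./ (y * y′)
  /-*-/ x (suc y) x′ (suc y′) = *≡* (cong (ℤ._* + (suc y * suc y′)) (sym (pos-* x x′)))

  n/n≃1 : ∀ x y .{{_ : NonZero y}} → x ≡ y → + x ℚᵘ./ y ≃ ℚᵘ.1ℚᵘ
  n/n≃1 x (suc y) refl = *≡* (trans (*-identityʳ +[1+ y ]) (sym (*-identityˡ +[1+ y ])))

  inv2^-+ : ∀ a b → inv2^ (a + b) ≡ inv2^ a ℚ.* inv2^ b
  inv2^-+ a b = toℚᵘ-injective (begin
    toℚᵘ (inv2^ (a + b))                       ≈⟨ toℚᵘ-/ (+ 1) (2 ^ (a + b)) ⟩
    + 1 ℚᵘ./ 2 ^ (a + b)                       ≡⟨ cong-/ (^-distribˡ-+-* 2 a b) ⟩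
    + (1 * 1) ℚᵘ./ (2 ^ a * 2 ^ b)             ≈⟨ /-*-/ 1 (2 ^ a) 1 (2 ^ b) ⟨
    (+ 1 ℚᵘ./ 2 ^ a) ℚᵘ.* (+ 1 ℚᵘ./ 2 ^ b)
      ≈⟨ ℚᵘ.*-cong (toℚᵘ-/ (+ 1) (2 ^ a)) (toℚᵘ-/ (+ 1) (2 ^ b)) ⟨
    toℚᵘ (inv2^ a) ℚᵘ.* toℚᵘ (inv2^ b)         ≈⟨ toℚᵘ-homo-* (inv2^ a) (inv2^ b) ⟨
    toℚᵘ (inv2^ a ℚ.* inv2^ b)                 ∎)
    where
    open ℚᵘ.≃-Reasoning
    instance
      _ = m^n≢0 2 a
      _ = m^n≢0 2 b
      _ = m^n≢0 2 (a + b)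
      _ = m*n≢0 (2 ^ a) (2 ^ b)
    cong-/ : ∀ {y y′} .{{_ : NonZero y}} .{{_ : NonZero y′}} → y ≡ y′ → + 1 ℚᵘ./ y ≡ + 1 ℚᵘ./ y′
    cong-/ {suc y} refl = refl

  -- ⌈n/2⌉, so that scale n = 4 / 2 ^ halfUp n
  halfUp : ℕ → ℕ
  halfUp n = (n + ε n) ℕ./ 2

  n≤2*halfUp : ∀ n → n ≤ 2 * halfUp n
  n≤2*halfUp zero          = z≤n
  n≤2*halfUp (suc zero)    = s≤s z≤n
  n≤2*halfUp (suc (suc n))
    rewrite +-distrib-/-∣ˡ (n + ε n) (∣-refl {2}) | *-suc 2 (halfUp n) = s≤s (s≤s (n≤2*halfUp n))

  scale⁻¹ : ℕ → ℚ
  scale⁻¹ n = + (2 ^ halfUp n) ℚ./ 4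

  scale*scale⁻¹≡1 : ∀ n → scale n ℚ.* scale⁻¹ n ≡ 1ℚ
  scale*scale⁻¹≡1 n = toℚᵘ-injective (begin
    toℚᵘ (scale n ℚ.* scale⁻¹ n)                 ≈⟨ toℚᵘ-homo-* (scale n) (scale⁻¹ n) ⟩
    toℚᵘ (scale n) ℚᵘ.* toℚᵘ (scale⁻¹ n)
      ≈⟨ ℚᵘ.*-cong (toℚᵘ-/ (+ 4) (2 ^ k)) (toℚᵘ-/ (+ (2 ^ k)) 4) ⟩
    (+ 4 ℚᵘ./ 2 ^ k) ℚᵘ.* (+ (2 ^ k) ℚᵘ./ 4)     ≈⟨ /-*-/ 4 (2 ^ k) (2 ^ k) 4 ⟩
    + (4 * 2 ^ k) ℚᵘ./ (2 ^ k * 4)               ≈⟨ n/n≃1 (4 * 2 ^ k) (2 ^ k * 4) (*-comm 4 (2 ^ k)) ⟩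
    ℚᵘ.1ℚᵘ                                       ∎)
    where
    open ℚᵘ.≃-Reasoning
    k = halfUp n
    instance
      _ = m^n≢0 2 k
      _ = m*n≢0 (2 ^ k) 4

module Valuations where

  open TwoAdicIntegers using (Odd; odd-1; odd-*; odd-^; odd-1+2*)
  open import Data.Nat using (ℕ; zero; suc; _+_; _*_; _∸_; _^_; _≤_; _<_; z≤n; _!)
  open import Data.Nat.Properties
  open import Data.Nat.Induction using (<-rec)
  open import Data.Nat.Solver using (module +-*-Solver)
  open import Data.List using ([]; _∷_)
  open import Data.Product using (_×_; _,_; Σ)
  open import Data.Sum using (_⊎_; inj₁; inj₂)
  open import Relation.Binary.PropositionalEquality
  open +-*-Solver

  Val₂≤ : ℕ → ℕ → Set
  Val₂≤ n b = Σ ℕ λ v → Σ ℕ λ o → Odd o × (n ≡ 2 ^ v * o) × v ≤ b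

  even⊎odd : ∀ e → Σ ℕ λ h → e ≡ 2 * h ⊎ e ≡ suc (2 * h)
  even⊎odd zero = 0 , inj₁ refl
  even⊎odd (suc e) with even⊎odd e
  ... | h , inj₁ e≡2h  = h , inj₂ (cong suc e≡2h)
  ... | h , inj₂ e≡2h+1 = suc h , inj₁ (trans (cong suc e≡2h+1) (sym (*-suc 2 h)))

  [2*h]! : ∀ h → Σ ℕ λ o → Odd o × (2 * h) ! ≡ 2 ^ h * h ! * o
  [2*h]! zero    = 1 , odd-1 , refl
  [2*h]! (suc h) with [2*h]! h
  ... | o , odd-o , eq = suc (2 * h) * o , odd-* (odd-1+2* h) odd-o , (begin
    (2 * suc h) !
      ≡⟨ cong _! (*-suc 2 h) ⟩
    (2 + 2 * h) * ((1 + 2 * h) * (2 * h) !)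
      ≡⟨ cong (λ x → (2 + 2 * h) * ((1 + 2 * h) * x)) eq ⟩
    (2 + 2 * h) * ((1 + 2 * h) * (2 ^ h * h ! * o))
      ≡⟨ solve 4 (λ h P F o → (con 2 :+ con 2 :* h) :* ((con 1 :+ con 2 :* h) :* (P :* F :* o))
                  := (con 2 :* P) :* ((con 1 :+ h) :* F) :* ((con 1 :+ con 2 :* h) :* o))
           refl h (2 ^ h) (h !) o ⟩
    2 ^ suc h * suc h ! * (suc (2 * h) * o) ∎)
    where open ≡-Reasoning

  factorial-halving : ∀ e → Σ ℕ λ h → Σ ℕ λ o → Odd o × (e ! ≡ 2 ^ h * h ! * o) × 2 * h ≤ e
  factorial-halving e with even⊎odd e
  ... | h , inj₁ refl with [2*h]! h
  ...   | o , odd-o , eq = h , o , odd-o , eq , ≤-refl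
  factorial-halving e | h , inj₂ refl with [2*h]! h
  ...   | o , odd-o , eq = h , suc (2 * h) * o , odd-* (odd-1+2* h) odd-o ,
    trans (cong (suc (2 * h) *_) eq)
      (solve 4 (λ s P F o → s :* (P :* F :* o) := P :* F :* (s :* o))
         refl (suc (2 * h)) (2 ^ h) (h !) o) ,
    n≤1+n _

  -- Legendre: v₂(e!) = ⌊e/2⌋ + v₂(⌊e/2⌋!), and strong induction on e
  factorial-val₂ : ∀ e → Val₂≤ (e !) (e ∸ 1)
  factorial-val₂ = <-rec (λ e → Val₂≤ (e !) (e ∸ 1)) step
    where
    step : ∀ e → (∀ {e′} → e′ < e → Val₂≤ (e′ !) (e′ ∸ 1)) → Val₂≤ (e !) (e ∸ 1)
    step e rec with factorial-halving e
    ... | zero , o , odd-o , eq , _ = 0 , o , odd-o , eq , z≤n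
    ... | suc h , o , odd-o , eq , 2h≤e
        with rec (<-≤-trans (m<m*n (suc h) 2 ≤-refl) (subst (_≤ e) (*-comm 2 (suc h)) 2h≤e))
    ...   | v , o′ , odd-o′ , eq′ , v≤h = suc h + v , o′ * o , odd-* odd-o′ odd-o , e!≡ , suc-h+v≤e∸1
      where
      e!≡ : e ! ≡ 2 ^ (suc h + v) * (o′ * o)
      e!≡ = begin
        e !                           ≡⟨ eq ⟩
        2 ^ suc h * suc h ! * o       ≡⟨ cong (λ x → 2 ^ suc h * x * o) eq′ ⟩
        2 ^ suc h * (2 ^ v * o′) * o  ≡⟨ solve 4 (λ P Q o′ o → P :* (Q :* o′) :* o := P :* Q :* (o′ :* o))
                                           refl (2 ^ suc h) (2 ^ v) o′ o ⟩
        2 ^ suc h * 2 ^ v * (o′ * o)  ≡⟨ cong (_* (o′ * o)) (^-distribˡ-+-* 2 (suc h) v) ⟨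
        2 ^ (suc h + v) * (o′ * o)    ∎
        where open ≡-Reasoning
      suc-h+v≤e∸1 : suc h + v ≤ e ∸ 1
      suc-h+v≤e∸1 = begin
        suc h + v           ≤⟨ +-monoʳ-≤ (suc h) v≤h ⟩
        suc (h + h)         ≡⟨ cong (λ x → suc (h + x)) (+-identityʳ h) ⟨
        suc (2 * h)         ≡⟨ +-suc h (h + 0) ⟨
        2 * suc h ∸ 1       ≤⟨ ∸-monoˡ-≤ 1 2h≤e ⟩
        e ∸ 1               ∎
        where open ≤-Reasoning

  m∸1+n∸1≤m+n∸1 : ∀ m n → (m ∸ 1) + (n ∸ 1) ≤ (m + n) ∸ 1
  m∸1+n∸1≤m+n∸1 zero    n = ≤-refl
  m∸1+n∸1≤m+n∸1 (suc m) n = +-monoʳ-≤ m (m∸n≤m n 1)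

  zFrom-val₂ : ∀ k m → Val₂≤ (zFrom k m) (len m ∸ 1)
  zFrom-val₂ k []      = 0 , 1 , odd-1 , refl , z≤n
  zFrom-val₂ k (e ∷ m) with factorial-val₂ e | zFrom-val₂ (suc k) m
  ... | v , o , odd-o , eq , v≤ | V , O , odd-O , eq′ , V≤ =
    v + V , p ^ e * o * O , odd-* (odd-* (odd-^ e (odd-1+2* k)) odd-o) odd-O , z≡ ,
    ≤-trans (+-mono-≤ v≤ V≤) (m∸1+n∸1≤m+n∸1 e (len m))
    where
    p = suc (2 * k)
    z≡ : zFrom k (e ∷ m) ≡ 2 ^ (v + V) * (p ^ e * o * O)
    z≡ = begin
      p ^ e * e ! * zFrom (suc k) m     ≡⟨ cong₂ (λ x y → p ^ e * x * y) eq eq′ ⟩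
      p ^ e * (2 ^ v * o) * (2 ^ V * O) ≡⟨ solve 5 (λ A P o Q O → A :* (P :* o) :* (Q :* O)
                                                      := P :* Q :* (A :* o :* O))
                                             refl (p ^ e) (2 ^ v) o (2 ^ V) O ⟩
      2 ^ v * 2 ^ V * (p ^ e * o * O)   ≡⟨ cong (_* (p ^ e * o * O)) (^-distribˡ-+-* 2 v V) ⟨
      2 ^ (v + V) * (p ^ e * o * O)     ∎
      where open ≡-Reasoning

module CoefficientsOfQ where

  open Monomials using (sizeFrom≡len+2*weightFrom; len≡0⇒sizeFrom≡0)
  open TwoAdicIntegers using (Inℤ₍₂₎-2^e/odd)
  open Fractions
  open Valuations using (zFrom-val₂)
  open import Data.Nat as ℕ using (ℕ; suc; _+_; _*_; _∸_; _^_; _≤_; _<_; s≤s)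
  open import Data.Nat.Properties
  open import Data.Nat.Solver using (module +-*-Solver)
  open import Data.Integer using (+_)
  open import Data.Rational as ℚ using (toℚᵘ)
  open import Data.Rational.Properties using (toℚᵘ-homo-*)
  open import Data.Rational.Unnormalised as ℚᵘ using (_≃_)
  import Data.Rational.Unnormalised.Properties as ℚᵘ
  open import Data.Product using (_,_)
  open import Relation.Binary.PropositionalEquality
  open +-*-Solver

  toℚᵘ-scale⁻¹*qCoeff*inv2^ : ∀ n m w .{{_ : ℕ.NonZero (4 * z m * 2 ^ w)}} →
    toℚᵘ (scale⁻¹ n ℚ.* qCoeff m ℚ.* inv2^ w)
      ≃ + (2 ^ halfUp n * 2 ^ len m * 1) ℚᵘ./ (4 * z m * 2 ^ w)
  toℚᵘ-scale⁻¹*qCoeff*inv2^ n m w = begin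
    toℚᵘ (scale⁻¹ n ℚ.* qCoeff m ℚ.* inv2^ w)
      ≈⟨ toℚᵘ-homo-* (scale⁻¹ n ℚ.* qCoeff m) (inv2^ w) ⟩
    toℚᵘ (scale⁻¹ n ℚ.* qCoeff m) ℚᵘ.* toℚᵘ (inv2^ w)
      ≈⟨ ℚᵘ.*-cong (toℚᵘ-homo-* (scale⁻¹ n) (qCoeff m)) ℚᵘ.≃-refl ⟩
    toℚᵘ (scale⁻¹ n) ℚᵘ.* toℚᵘ (qCoeff m) ℚᵘ.* toℚᵘ (inv2^ w)
      ≈⟨ ℚᵘ.*-cong (ℚᵘ.*-cong (toℚᵘ-/ (+ (2 ^ k)) 4) (toℚᵘ-/ (+ (2 ^ ℓ)) (z m)))
                   (toℚᵘ-/ (+ 1) (2 ^ w)) ⟩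
    (+ (2 ^ k) ℚᵘ./ 4) ℚᵘ.* (+ (2 ^ ℓ) ℚᵘ./ z m) ℚᵘ.* (+ 1 ℚᵘ./ 2 ^ w)
      ≈⟨ ℚᵘ.*-cong (/-*-/ (2 ^ k) 4 (2 ^ ℓ) (z m)) ℚᵘ.≃-refl ⟩
    (+ (2 ^ k * 2 ^ ℓ) ℚᵘ./ (4 * z m)) ℚᵘ.* (+ 1 ℚᵘ./ 2 ^ w)
      ≈⟨ /-*-/ (2 ^ k * 2 ^ ℓ) (4 * z m) 1 (2 ^ w) ⟩
    + (2 ^ k * 2 ^ ℓ * 1) ℚᵘ./ (4 * z m * 2 ^ w) ∎
    where
    open ℚᵘ.≃-Reasoning
    k = halfUp n
    ℓ = len m
    instance
      _ = zFrom≢0 0 m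
      _ = m^n≢0 2 w
      _ = m*n≢0 4 (z m)

  -- counts the factors of 2 in 2^k 2^ℓ / (4 · z m · 2^w), where z m = 2^V · odd with V ≤ ℓ - 1
  2+V+w≤halfUp+ℓ : ∀ {n ℓ w V} → 1 ≤ ℓ → n ≡ ℓ + 2 * w → V ≤ ℓ ∸ 1 → 2 + (V + w) ≤ halfUp n + ℓ
  2+V+w≤halfUp+ℓ {n} {suc ℓ} {w} {V} 1≤ℓ n≡ V≤ℓ = begin
    2 + (V + w)      ≡⟨ solve 2 (λ V w → con 2 :+ (V :+ w) := (con 1 :+ w) :+ (con 1 :+ V)) refl V w ⟩
    suc w + suc V    ≤⟨ +-mono-≤ w<k (s≤s V≤ℓ) ⟩
    halfUp n + suc ℓ ∎
    where
    open ≤-Reasoning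
    w<k : w < halfUp n
    w<k = *-cancelˡ-< 2 w (halfUp n) (begin-strict
      2 * w            <⟨ m<m+n (2 * w) 1≤ℓ ⟩
      2 * w + suc ℓ    ≡⟨ trans (+-comm (2 * w) (suc ℓ)) (sym n≡) ⟩
      n                ≤⟨ n≤2*halfUp n ⟩
      2 * halfUp n     ∎)

  2^k*2^ℓ≡2^e*[4*z*2^w] : ∀ k ℓ V w e O → 2 + (V + w) + e ≡ k + ℓ →
    2 ^ k * 2 ^ ℓ * 1 * O ≡ 2 ^ e * (4 * (2 ^ V * O) * 2 ^ w)
  2^k*2^ℓ≡2^e*[4*z*2^w] k ℓ V w e O eq = begin
    2 ^ k * 2 ^ ℓ * 1 * O                   ≡⟨ cong (λ x → x * 1 * O) (^-distribˡ-+-* 2 k ℓ) ⟨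
    2 ^ (k + ℓ) * 1 * O                     ≡⟨ cong (λ x → 2 ^ x * 1 * O) eq ⟨
    2 ^ (2 + (V + w) + e) * 1 * O
      ≡⟨ cong (λ x → x * 1 * O) (^-distribˡ-+-* 2 (2 + (V + w)) e) ⟩
    2 * (2 * 2 ^ (V + w)) * 2 ^ e * 1 * O
      ≡⟨ cong (λ x → 2 * (2 * x) * 2 ^ e * 1 * O) (^-distribˡ-+-* 2 V w) ⟩
    2 * (2 * (2 ^ V * 2 ^ w)) * 2 ^ e * 1 * O
      ≡⟨ solve 4 (λ a b c O → con 2 :* (con 2 :* (a :* b)) :* c :* con 1 :* O
                  := c :* (con 4 :* (a :* O) :* b)) refl (2 ^ V) (2 ^ w) (2 ^ e) O ⟩
    2 ^ e * (4 * (2 ^ V * O) * 2 ^ w)       ∎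
    where open ≡-Reasoning

  scaled-qCoeff-Inℤ₍₂₎ : ∀ n → 1 ≤ n → ∀ m → size m ≡ n →
    Inℤ₍₂₎ (scale⁻¹ n ℚ.* qCoeff m ℚ.* inv2^ (weight m))
  scaled-qCoeff-Inℤ₍₂₎ n 1≤n m size≡n =
    let V , O , odd-O , z≡ , V≤ = zFrom-val₂ 0 m
        e , e-eq = m≤n⇒∃[o]m+o≡n (2+V+w≤halfUp+ℓ 1≤ℓ n≡ℓ+2w V≤)
    in Inℤ₍₂₎-2^e/odd _ _ _ e O (toℚᵘ-scale⁻¹*qCoeff*inv2^ n m w) odd-O
         (trans (2^k*2^ℓ≡2^e*[4*z*2^w] (halfUp n) (len m) V w e O e-eq)
                (cong (λ x → 2 ^ e * (4 * x * 2 ^ w)) (sym z≡)))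
    where
    instance
      _ = zFrom≢0 0 m
      _ = m^n≢0 2 (weight m)
      _ = m*n≢0 4 (z m)
      _ = m*n≢0 (4 * z m) (2 ^ weight m)
    w = weight m
    n≡ℓ+2w : n ≡ len m + 2 * w
    n≡ℓ+2w = trans (sym size≡n) (sizeFrom≡len+2*weightFrom 0 m)
    1≤ℓ : 1 ≤ len m
    1≤ℓ = n≢0⇒n>0 λ ℓ≡0 →
      1+n≰n (≤-trans 1≤n (≤-reflexive (trans (sym size≡n) (len≡0⇒sizeFrom≡0 0 m ℓ≡0))))

open Monomials using (mdiv; _∣ᴹ?_; strip≡⇒weight≡; weightFrom-mmul)
open Coefficients
open TwoAdicIntegers using (Inℤ₍₂₎-0; Inℤ₍₂₎-+; Inℤ₍₂₎-*)
open Fractions using (inv2^-+; scale⁻¹; scale*scale⁻¹≡1)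
open CoefficientsOfQ using (scaled-qCoeff-Inℤ₍₂₎)
import Data.Nat as ℕ
open import Data.Rational using (ℚ; 0ℚ; 1ℚ; _+_; _*_)
open import Data.Rational.Properties
  using (*-zeroʳ; *-zeroˡ; *-assoc; *-identityˡ; *-distribˡ-+; *-distribʳ-+)
open import Data.Rational.Solver using (module +-*-Solver)
open import Data.List using ([]; _∷_)
open import Data.List.Relation.Unary.All as All using (All; []; _∷_)
open import Data.List.Relation.Unary.All.Properties using (map⁺; all-filter)
open import Data.Product using (_×_; _,_; proj₁; proj₂)
open import Relation.Binary.PropositionalEquality
open import Relation.Nullary using (yes; no)

TermInΔ : ℚ × Mono → Set
TermInΔ (a , m) = Inℤ₍₂₎ (a * inv2^ (weight m))

-- the coordinate of c · R along the basis vector 2 ^ weight m · p_m of Δ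
Δ-coeff : ℚ → Poly → Mono → ℚ
Δ-coeff c R m = c * coeff R m * inv2^ (weight m)

c*0*d≡0 : ∀ c d → c * 0ℚ * d ≡ 0ℚ
c*0*d≡0 c d = trans (cong (_* d) (*-zeroʳ c)) (*-zeroˡ d)

Δ-coeff-∷-*P : ∀ c t P Q m →
  Δ-coeff c ((t ∷ P) *P Q) m ≡ Δ-coeff c ((t ∷ []) *P Q) m + Δ-coeff c (P *P Q) m
Δ-coeff-∷-*P c t P Q m rewrite coeff-∷-*P t P Q m
  | *-distribˡ-+ c (coeff ((t ∷ []) *P Q) m) (coeff (P *P Q) m) =
  *-distribʳ-+ (inv2^ (weight m)) (c * coeff ((t ∷ []) *P Q) m) (c * coeff (P *P Q) m)

Δ-coeff-term-*P : ∀ c a m₁ x m → TermInΔ (c * a , m₁) → InΔ x →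
  Inℤ₍₂₎ (Δ-coeff c (((a , m₁) ∷ []) *P x) m)
Δ-coeff-term-*P c a m₁ x m ca∈ x∈Δ with m₁ ∣ᴹ? m
... | no m₁∤m = subst Inℤ₍₂₎ (sym vanishes) Inℤ₍₂₎-0
  where
  vanishes : Δ-coeff c (((a , m₁) ∷ []) *P x) m ≡ 0ℚ
  vanishes rewrite coeff-term-*P-∤ a m₁ x m m₁∤m = c*0*d≡0 c (inv2^ (weight m))
... | yes m₁∣m =
  subst Inℤ₍₂₎ (sym factorises)
    (Inℤ₍₂₎-* {c * a * inv2^ (weight m₁)} {coeff x m₀ * inv2^ (weight m₀)} ca∈ (x∈Δ m₀))
  where
  open +-*-Solver
  m₀ = mdiv m m₁
  weight-m : weight m ≡ weight m₁ ℕ.+ weight m₀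
  weight-m = trans (strip≡⇒weight≡ m (mmul m₁ m₀) (sym m₁∣m)) (weightFrom-mmul 0 m₁ m₀)
  factorises : Δ-coeff c (((a , m₁) ∷ []) *P x) m
             ≡ (c * a * inv2^ (weight m₁)) * (coeff x m₀ * inv2^ (weight m₀))
  factorises rewrite coeff-term-*P a m₁ x m m₁∣m | weight-m | inv2^-+ (weight m₁) (weight m₀) =
    solve 5 (λ c a X p q → c :* (a :* X) :* (p :* q) := (c :* a :* p) :* (X :* q))
      refl c a (coeff x m₀) (inv2^ (weight m₁)) (inv2^ (weight m₀))

Δ-coeff-*P : ∀ c P x m → All TermInΔ (c ·P P) → InΔ x → Inℤ₍₂₎ (Δ-coeff c (P *P x) m)
Δ-coeff-*P c []       x m []       x∈Δ = subst Inℤ₍₂₎ (sym (c*0*d≡0 c (inv2^ (weight m)))) Inℤ₍₂₎-0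
Δ-coeff-*P c (t ∷ P) x m (t∈ ∷ P∈) x∈Δ =
  subst Inℤ₍₂₎ (sym (Δ-coeff-∷-*P c t P x m))
    (Inℤ₍₂₎-+ {Δ-coeff c ((t ∷ []) *P x) m} {Δ-coeff c (P *P x) m}
      (Δ-coeff-term-*P c (proj₁ t) (proj₂ t) x m t∈ x∈Δ) (Δ-coeff-*P c P x m P∈ x∈Δ))

scaled-*P-InΔ : ∀ c P x → All TermInΔ (c ·P P) → InΔ x → InΔ (c ·P (P *P x))
scaled-*P-InΔ c P x P∈ x∈Δ m =
  subst Inℤ₍₂₎ (cong (_* inv2^ (weight m)) (sym (coeff-·P c (P *P x) m))) (Δ-coeff-*P c P x m P∈ x∈Δ)

·P-·P-inverse : ∀ c d P → c * d ≡ 1ℚ → P ≈P (c ·P (d ·P P))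
·P-·P-inverse c d P cd≡1 m = sym (begin
  coeff (c ·P (d ·P P)) m  ≡⟨ coeff-·P c (d ·P P) m ⟩
  c * coeff (d ·P P) m     ≡⟨ cong (c *_) (coeff-·P d P m) ⟩
  c * (d * coeff P m)      ≡⟨ *-assoc c d (coeff P m) ⟨
  c * d * coeff P m        ≡⟨ cong (_* coeff P m) cd≡1 ⟩
  1ℚ * coeff P m           ≡⟨ *-identityˡ (coeff P m) ⟩
  coeff P m                ∎)
  where open ≡-Reasoning

scaled-q-termwise-InΔ : ∀ n → 1 ≤ n → All TermInΔ (scale⁻¹ n ·P q n)
scaled-q-termwise-InΔ n 1≤n =
  map⁺ (map⁺ (All.map (λ {m} → scaled-qCoeff-Inℤ₍₂₎ n 1≤n m)
                      (all-filter (λ m → size m ℕ.≟ n) (vecs n n))))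

lemma3p2 : (n : ℕ) → 1 ≤ n → (x : Poly) → InΔ x → InScaledΔ (scale n) (q n *P x)
lemma3p2 n 1≤n x x∈Δ =
  scale⁻¹ n ·P (q n *P x) ,
  scaled-*P-InΔ (scale⁻¹ n) (q n) x (scaled-q-termwise-InΔ n 1≤n) x∈Δ ,
  ·P-·P-inverse (scale n) (scale⁻¹ n) (q n *P x) (scale*scale⁻¹≡1 n)
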